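{- For any graphs $G$ and $H$, $\gamma(G\diamond H)\geq3$ if and only if both of the following hold: (i) $\gamma(G)+\gamma(H)\geq4$; (ii) neither $G$ nor $H$ has an ECD set of size $2$.
   Context: All graphs are finite, simple and undirected. The modular product $G\diamond H$ has vertex set $V(G)\times V(H)$, and two distinct vertices $(g,h)$ and $(g',h')$ are adjacent iff either ($g=g'$ and $hh'\in E(H)$), or ($gg'\in E(G)$ and $h=h'$), or ($gg'\in E(G)$ and $hh'\in E(H)$), or ($g\neq g'$, $h\neq h'$, $gg'\notin E(G)$ and $hh'\notin E(H)$). $\gamma(G)$ denotes the domination number of $G$. A set $D\subseteq V(G)$ is an efficiently closed dominating (ECD) set of $G$ if the closed neighborhoods $\{N_G[v]:v\in D\}$ form a partition of $V(G)$. -}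

module Defs where

open import Data.Nat using (ℕ; zero; suc; _*_; _⊓_)
open import Data.Fin using (Fin; _≟_; remQuot)
open import Data.Fin.Properties using (any?; all?)
open import Data.Fin.Subset using (Subset; _∈_; ∣_∣; inside; outside)
open import Data.Fin.Subset.Properties using (_∈?_)
open import Data.Vec using ([]; _∷_)
open import Data.List using (List; []; _∷_; map; _++_; foldr; filter)
open import Data.Product using (_×_; _,_; proj₁; proj₂; ∃; ∃-syntax)
open import Data.Sum using (_⊎_; inj₁; inj₂)
open import Relation.Nullary using (¬_; Dec; yes; no)
open import Relation.Nullary.Decidable using (_⊎-dec_; _×-dec_; ¬?)
open import Relation.Binary.PropositionalEquality using (_≡_; _≢_; refl; sym)

record Graph : Set₁ where
  field
    n      : ℕ
    Adj    : Fin n → Fin n → Set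
    adj?   : ∀ u v → Dec (Adj u v)
    symAdj : ∀ {u v} → Adj u v → Adj v u
    irrefl : ∀ {u} → ¬ Adj u u
open Graph public

InClosedNbhd : (G : Graph) → Fin (n G) → Fin (n G) → Set
InClosedNbhd G u v = (u ≡ v) ⊎ Adj G u v

inClosedNbhd? : (G : Graph) → ∀ u v → Dec (InClosedNbhd G u v)
inClosedNbhd? G u v = (u ≟ v) ⊎-dec adj? G u v

Dominating : (G : Graph) → Subset (n G) → Set
Dominating G D = ∀ v → ∃[ u ] (u ∈ D × InClosedNbhd G u v)

dominating? : (G : Graph) → (D : Subset (n G)) → Dec (Dominating G D)
dominating? G D = all? (λ v → any? (λ u → (u ∈? D) ×-dec inClosedNbhd? G u v))

allSubsets : (k : ℕ) → List (Subset k)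
allSubsets zero    = [] ∷ []
allSubsets (suc k) = map (inside ∷_) (allSubsets k) ++ map (outside ∷_) (allSubsets k)

-- domination number: minimum size of a dominating set
-- (the full vertex set is dominating, so n G is an upper bound)
γ : Graph → ℕ
γ G = foldr _⊓_ (n G) (map ∣_∣ (filter (dominating? G) (allSubsets (n G))))

ECD : (G : Graph) → Subset (n G) → Set
ECD G D = ∀ v → ∃[ u ] ((u ∈ D × InClosedNbhd G u v)
                        × (∀ w → w ∈ D → InClosedNbhd G w v → w ≡ u))

HasECDOfSize : Graph → ℕ → Set
HasECDOfSize G k = ∃[ D ] (ECD G D × ∣ D ∣ ≡ k)

module _ (G H : Graph) where
  private
    V = Fin (n G * n H)
    fst : V → Fin (n G)
    fst x = proj₁ (remQuot {n G} (n H) x)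
    snd : V → Fin (n H)
    snd x = proj₂ (remQuot {n G} (n H) x)

  ModAdj' : Fin (n G) → Fin (n H) → Fin (n G) → Fin (n H) → Set
  ModAdj' g h g' h' =
      (g ≡ g' × Adj H h h')
    ⊎ (Adj G g g' × h ≡ h')
    ⊎ (Adj G g g' × Adj H h h')
    ⊎ (g ≢ g' × h ≢ h' × ¬ Adj G g g' × ¬ Adj H h h')

  ModAdj : V → V → Set
  ModAdj x y = x ≢ y × ModAdj' (fst x) (snd x) (fst y) (snd y)

  modAdj? : ∀ x y → Dec (ModAdj x y)
  modAdj? x y = ¬? (x ≟ y) ×-dec
      (((g ≟ g') ×-dec adj? H h h')
    ⊎-dec ((adj? G g g' ×-dec (h ≟ h'))
    ⊎-dec ((adj? G g g' ×-dec adj? H h h')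
    ⊎-dec (¬? (g ≟ g') ×-dec (¬? (h ≟ h') ×-dec (¬? (adj? G g g') ×-dec ¬? (adj? H h h')))))))
    where
      g = fst x ; h = snd x ; g' = fst y ; h' = snd y

  modSym' : ∀ {g h g' h'} → ModAdj' g h g' h' → ModAdj' g' h' g h
  modSym' (inj₁ (e , a)) = inj₁ (sym e , symAdj H a)
  modSym' (inj₂ (inj₁ (a , e))) = inj₂ (inj₁ (symAdj G a , sym e))
  modSym' (inj₂ (inj₂ (inj₁ (a , b)))) = inj₂ (inj₂ (inj₁ (symAdj G a , symAdj H b)))
  modSym' (inj₂ (inj₂ (inj₂ (p , q , r , s)))) =
    inj₂ (inj₂ (inj₂ ((λ e → p (sym e)) , (λ e → q (sym e))
                     , (λ a → r (symAdj G a)) , (λ a → s (symAdj H a)))))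

  _◇_ : Graph
  _◇_ = record
    { n = n G * n H
    ; Adj = ModAdj
    ; adj? = modAdj?
    ; symAdj = λ { (d , a) → (λ e → d (sym e)) , modSym' a }
    ; irrefl = λ { (d , _) → d refl }
    }

-- In G ◇ H the closed neighbourhood of (g , h) consists of the (g′ , h′) with
-- g′ ∈ N[g] ⇔ h′ ∈ N[h].  Reading closed neighbourhoods as Boolean functions
-- pᵢ = N[gᵢ] and qᵢ = N[hᵢ], the vertices (g₁ , h₁) and (g₂ , h₂) dominate G ◇ H
-- iff p₁ g = q₁ h or p₂ g = q₂ h for all g, h: no pattern (p₁ g , p₂ g) is the
-- bitwise complement of a pattern (q₁ h , q₂ h).  As p₂ g₂ = q₁ h₁ = true, a case
-- analysis on the patterns occurring shows that this happens exactly when a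
-- vertex of one factor and a pair of the other factor dominate, or when N[g₁],
-- N[g₂] (or N[h₁], N[h₂]) partition their graph, i.e. form an ECD set of size 2.
-- So γ (G ◇ H) ≤ 2 iff γ G + γ H ≤ 3 (using γ ≥ 1) or a factor has such an ECD set.
module Submission where

open import Defs
open import Data.Bool using (Bool; true; false; not)
open import Data.Bool.Properties using (not-¬; ¬-not) renaming (_≟_ to _≟ᵇ_)
open import Data.Empty using (⊥; ⊥-elim)
open import Data.Fin using (Fin; zero; suc; combine; remQuot; fromℕ<) renaming (_≟_ to _≟ᶠ_)
open import Data.Fin.Properties using (suc-injective; remQuot-combine; combine-remQuot; all?; ¬∀⟶∃¬)
open import Data.Fin.Subset using (Subset; _∈_; ∣_∣; inside; outside; ⁅_⁆; _∪_; ⊤; Nonempty) renaming (⊥ to ∅)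
open import Data.Fin.Subset.Properties
  using (x∈⁅x⁆; x∈⁅y⁆⇒x≡y; ∣⁅x⁆∣≡1; ∪-identityˡ; ∪-identityʳ; ∪-idem; x∈p∪q⁻; x∈p∪q⁺; ∣p∣≤∣x∷p∣; ∈⊤; ∣⊤∣≡n)
open import Data.List using (map; foldr; filter)
open import Data.List.Properties using (foldr-forcesᵇ)
import Data.List.Membership.Propositional as List
open import Data.List.Membership.Propositional.Properties
  using (∈-map⁺; ∈-map⁻; ∈-++⁺ˡ; ∈-++⁺ʳ; ∈-filter⁺; ∈-filter⁻; foldr-selective)
open import Data.List.Relation.Unary.All as All using (All)
open import Data.List.Relation.Unary.Any using (here)
open import Data.Nat using (ℕ; zero; suc; _*_; _+_; _≤_; _⊓_; z≤n; s≤s)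
open import Data.Nat.Properties
  using (≤-refl; ≤-trans; ≤-reflexive; ≤-antisym; m⊓n≤m; m⊓n≤n; ⊓-sel; +-mono-≤; <⇒≱; ≰⇒>)
  renaming (suc-injective to ℕ-suc-injective)
open import Data.Product using (_×_; _,_; proj₁; proj₂; ∃-syntax; ∃₂)
import Data.Product as Product
open import Data.Product.Function.NonDependent.Propositional using (_×-⇔_)
open import Data.Sum using (_⊎_; inj₁; inj₂; [_,_])
import Data.Sum as Sum
open import Data.Sum.Function.Propositional using (_⊎-⇔_)
open import Data.Vec using (_∷_; []; here; there)
open import Function using (_∘_; id)
open import Function.Bundles using (_⇔_; mk⇔; Equivalence)
open import Function.Properties.Equivalence using (⇔-setoid)
  renaming (refl to ⇔-refl; sym to ⇔-sym; trans to ⇔-trans)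
open import Function.Related.TypeIsomorphisms using (¬-cong-⇔)
open import Level using (0ℓ)
open import Relation.Binary.PropositionalEquality
  using (_≡_; _≢_; refl; sym; trans; cong; cong₂; subst; module ≡-Reasoning)
import Relation.Binary.Reasoning.Setoid as SetoidReasoning
open import Relation.Nullary using (¬_; Dec; yes; no; does; contradiction)
open import Relation.Nullary.Decidable using (dec-true; _⊎-dec_)

open Equivalence using (to; from)

private
  variable
    A B : Set
    k : ℕ

does≡true⇔ : (A? : Dec A) → does A? ≡ true ⇔ A
does≡true⇔ (yes a) = mk⇔ (λ _ → a) (λ _ → refl)
does≡true⇔ (no ¬a) = mk⇔ (λ ()) (λ a → contradiction a ¬a)

BothOrNeither : Set → Set → Set
BothOrNeither A B = (A × B) ⊎ (¬ A × ¬ B)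

does≡does⇔ : (A? : Dec A) (B? : Dec B) → does A? ≡ does B? ⇔ BothOrNeither A B
does≡does⇔ (yes a) (yes b) = mk⇔ (λ _ → inj₁ (a , b)) (λ _ → refl)
does≡does⇔ (yes a) (no ¬b) = mk⇔ (λ ()) [ (λ (_ , b) → contradiction b ¬b) , (λ (¬a , _) → contradiction a ¬a) ]
does≡does⇔ (no ¬a) (yes b) = mk⇔ (λ ()) [ (λ (a , _) → contradiction a ¬a) , (λ (_ , ¬b) → contradiction b ¬b) ]
does≡does⇔ (no ¬a) (no ¬b) = mk⇔ (λ _ → inj₂ (¬a , ¬b)) (λ _ → refl)

ExactlyOne : Set → Set → Set
ExactlyOne A B = (A ⊎ B) × ¬ (A × B)

does≡not-does⇔ : (A? : Dec A) (B? : Dec B) → does B? ≡ not (does A?) ⇔ ExactlyOne A B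
does≡not-does⇔ (yes a) (yes b) = mk⇔ (λ ()) (λ (_ , ¬ab) → contradiction (a , b) ¬ab)
does≡not-does⇔ (yes a) (no ¬b) = mk⇔ (λ _ → inj₁ a , ¬b ∘ proj₂) (λ _ → refl)
does≡not-does⇔ (no ¬a) (yes b) = mk⇔ (λ _ → inj₂ b , ¬a ∘ proj₁) (λ _ → refl)
does≡not-does⇔ (no ¬a) (no ¬b) = mk⇔ (λ ()) (λ (a⊎b , _) → contradiction a⊎b [ ¬a , ¬b ])

¬-⊎⇔ : (¬ (A ⊎ B)) ⇔ (¬ A × ¬ B)
¬-⊎⇔ = mk⇔ (λ ¬a⊎b → ¬a⊎b ∘ inj₁ , ¬a⊎b ∘ inj₂) (λ (¬a , ¬b) → [ ¬a , ¬b ])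

module _ {X : Set} where

  AllTrue : (X → Bool) → Set
  AllTrue f = ∀ x → f x ≡ true

  Covers : (X → Bool) → (X → Bool) → Set
  Covers f g = ∀ x → f x ≡ true ⊎ g x ≡ true

  Complementary : (X → Bool) → (X → Bool) → Set
  Complementary f g = ∀ x → g x ≡ not (f x)

≡⊎≡not : ∀ b c → b ≡ c ⊎ b ≡ not c
≡⊎≡not b c with b ≟ᵇ c
... | yes b≡c = inj₁ b≡c
... | no  b≢c = inj₂ (¬-not b≢c)

module _ {X : Set} {f g : X → Bool} where

  covers-resolve : Covers f g → ∀ {x} → f x ≡ false → g x ≡ true
  covers-resolve cov {x} fx≡false =
    [ (λ fx≡true → contradiction (trans (sym fx≡false) fx≡true) λ ()) , id ] (cov x)

  covers∧disjoint⇒complementary : Covers f g → (∀ x → f x ≡ true → g x ≡ true → ⊥) → Complementary f g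
  covers∧disjoint⇒complementary cov disjoint x with f x in fx | g x in gx
  ... | true  | true  = ⊥-elim (disjoint x fx gx)
  ... | true  | false = refl
  ... | false | true  = refl
  ... | false | false = contradiction (trans (sym gx) (covers-resolve cov fx)) λ ()

all-or-counterexample : ∀ {m} {P : Fin m → Set} → (∀ x → Dec (P x)) → (∀ x → P x) ⊎ ∃[ x ] ¬ P x
all-or-counterexample P? with all? P?
... | yes ∀P = inj₁ ∀P
... | no ¬∀P = inj₂ (¬∀⟶∃¬ _ _ P? ¬∀P)

allTrue-or-false : ∀ {m} (f : Fin m → Bool) → AllTrue f ⊎ ∃[ x ] f x ≡ false
allTrue-or-false f = Sum.map₂ (Product.map₂ ¬-not) (all-or-counterexample (λ x → f x ≟ᵇ true))

covers-or-bothFalse : ∀ {m} (f g : Fin m → Bool) → Covers f g ⊎ ∃[ x ] (f x ≡ false × g x ≡ false)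
covers-or-bothFalse f g =
  Sum.map₂ (Product.map₂ (λ ¬fx∨gx → ¬-not (¬fx∨gx ∘ inj₁) , ¬-not (¬fx∨gx ∘ inj₂)))
           (all-or-counterexample (λ x → (f x ≟ᵇ true) ⊎-dec (g x ≟ᵇ true)))

EitherAgrees : {X Y : Set} → (X → Bool) → (Y → Bool) → (X → Bool) → (Y → Bool) → Set
EitherAgrees p₁ q₁ p₂ q₂ = ∀ x y → p₁ x ≡ q₁ y ⊎ p₂ x ≡ q₂ y

module _ {m k} {p₁ p₂ : Fin m → Bool} {q₁ q₂ : Fin k → Bool} (agree : EitherAgrees p₁ q₁ p₂ q₂)
         {x₂} (p₂x₂ : p₂ x₂ ≡ true) {y₁} (q₁y₁ : q₁ y₁ ≡ true) where

  private
    opposite-excluded : ∀ {x y b₁ b₂} → p₁ x ≡ b₁ → p₂ x ≡ b₂ → q₁ y ≡ not b₁ → q₂ y ≡ not b₂ → ⊥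
    opposite-excluded {x} {y} p₁x p₂x q₁y q₂y =
      [ (λ e → not-¬ refl (trans (sym p₁x) (trans e q₁y)))
      , (λ e → not-¬ refl (trans (sym p₂x) (trans e q₂y))) ] (agree x y)

    -- (false , false) at y₀ forces p₁ x₂ ≡ false; then x₂ forces q₂ y₁ ≡ true, and y₁ clashes with x₀.
    bothFalse-on-both-sides-excluded : ∀ {x₀ y₀} → p₁ x₀ ≡ false → p₂ x₀ ≡ false →
                                       q₁ y₀ ≡ false → q₂ y₀ ≡ false → ⊥
    bothFalse-on-both-sides-excluded p₁x₀ p₂x₀ q₁y₀ q₂y₀ with p₁ x₂ in p₁x₂ | q₂ y₁ in q₂y₁
    ... | true  | _     = opposite-excluded p₁x₂ p₂x₂ q₁y₀ q₂y₀
    ... | false | false = opposite-excluded p₁x₂ p₂x₂ q₁y₁ q₂y₁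
    ... | false | true  = opposite-excluded p₁x₀ p₂x₀ q₁y₁ q₂y₁

  eitherAgrees-cases : ((AllTrue p₁ × Covers q₁ q₂) ⊎ (Covers p₁ p₂ × AllTrue q₂))
                       ⊎ Complementary p₁ p₂ ⊎ Complementary q₁ q₂
  eitherAgrees-cases with covers-or-bothFalse p₁ p₂ | covers-or-bothFalse q₁ q₂
  ... | inj₂ (_ , p₁x₀ , p₂x₀) | inj₂ (_ , q₁y₀ , q₂y₀) =
    ⊥-elim (bothFalse-on-both-sides-excluded p₁x₀ p₂x₀ q₁y₀ q₂y₀)
  ... | inj₂ (_ , p₁x₀ , p₂x₀) | inj₁ covq =
    inj₂ (inj₂ (covers∧disjoint⇒complementary covq (λ _ → opposite-excluded p₁x₀ p₂x₀)))
  ... | inj₁ covp | inj₂ (_ , q₁y₀ , q₂y₀) =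
    inj₂ (inj₁ (covers∧disjoint⇒complementary covp (λ _ p₁x p₂x → opposite-excluded p₁x p₂x q₁y₀ q₂y₀)))
  ... | inj₁ covp | inj₁ covq with allTrue-or-false p₁
  ...   | inj₁ allp₁       = inj₁ (inj₁ (allp₁ , covq))
  ...   | inj₂ (x , p₁x) = inj₁ (inj₂ (covp , allq₂))
    where
    allq₂ : AllTrue q₂
    allq₂ y with q₂ y in q₂y
    ... | true  = refl
    ... | false =
      ⊥-elim (opposite-excluded p₁x (covers-resolve covp p₁x) (covers-resolve (Sum.swap ∘ covq) q₂y) q₂y)

∣p∣≡0⇒p≡∅ : ∀ {n} {p : Subset n} → ∣ p ∣ ≡ 0 → p ≡ ∅
∣p∣≡0⇒p≡∅ {p = []}          _     = refl
∣p∣≡0⇒p≡∅ {p = outside ∷ p} ∣p∣≡0 = cong (outside ∷_) (∣p∣≡0⇒p≡∅ ∣p∣≡0)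

∣p∣≡1⇒p≡⁅x⁆ : ∀ {n} {p : Subset n} → ∣ p ∣ ≡ 1 → ∃[ x ] p ≡ ⁅ x ⁆
∣p∣≡1⇒p≡⁅x⁆ {p = inside  ∷ p} ∣p∣≡1 = zero , cong (inside ∷_) (∣p∣≡0⇒p≡∅ (ℕ-suc-injective ∣p∣≡1))
∣p∣≡1⇒p≡⁅x⁆ {p = outside ∷ p} ∣p∣≡1 = Product.map suc (cong (outside ∷_)) (∣p∣≡1⇒p≡⁅x⁆ ∣p∣≡1)

∣p∣≡2⇒p≡⁅x⁆∪⁅y⁆ : ∀ {n} {p : Subset n} → ∣ p ∣ ≡ 2 → ∃₂ λ x y → x ≢ y × p ≡ ⁅ x ⁆ ∪ ⁅ y ⁆
∣p∣≡2⇒p≡⁅x⁆∪⁅y⁆ {p = inside ∷ p} ∣p∣≡2 =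
  let y , p≡⁅y⁆ = ∣p∣≡1⇒p≡⁅x⁆ (ℕ-suc-injective ∣p∣≡2)
  in zero , suc y , (λ ()) , cong (inside ∷_) (trans p≡⁅y⁆ (sym (∪-identityˡ ⁅ y ⁆)))
∣p∣≡2⇒p≡⁅x⁆∪⁅y⁆ {p = outside ∷ p} ∣p∣≡2 =
  let x , y , x≢y , p≡⁅x⁆∪⁅y⁆ = ∣p∣≡2⇒p≡⁅x⁆∪⁅y⁆ ∣p∣≡2
  in suc x , suc y , x≢y ∘ suc-injective , cong (outside ∷_) p≡⁅x⁆∪⁅y⁆

∣⁅x⁆∪⁅y⁆∣≡2 : ∀ {n} {x y : Fin n} → x ≢ y → ∣ ⁅ x ⁆ ∪ ⁅ y ⁆ ∣ ≡ 2
∣⁅x⁆∪⁅y⁆∣≡2 {x = zero}  {zero}  x≢y = contradiction refl x≢y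
∣⁅x⁆∪⁅y⁆∣≡2 {x = zero}  {suc y} _   = cong suc (trans (cong ∣_∣ (∪-identityˡ ⁅ y ⁆)) (∣⁅x⁆∣≡1 y))
∣⁅x⁆∪⁅y⁆∣≡2 {x = suc x} {zero}  _   = cong suc (trans (cong ∣_∣ (∪-identityʳ ⁅ x ⁆)) (∣⁅x⁆∣≡1 x))
∣⁅x⁆∪⁅y⁆∣≡2 {x = suc x} {suc y} x≢y = ∣⁅x⁆∪⁅y⁆∣≡2 (x≢y ∘ cong suc)

∣⁅x⁆∪⁅y⁆∣≤2 : ∀ {n} (x y : Fin n) → ∣ ⁅ x ⁆ ∪ ⁅ y ⁆ ∣ ≤ 2
∣⁅x⁆∪⁅y⁆∣≤2 x y with x ≟ᶠ y
... | yes refl rewrite ∪-idem ⁅ x ⁆ | ∣⁅x⁆∣≡1 x = s≤s z≤n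
... | no x≢y = ≤-reflexive (∣⁅x⁆∪⁅y⁆∣≡2 x≢y)

nonempty⇒1≤∣p∣ : ∀ {n} {p : Subset n} → Nonempty p → 1 ≤ ∣ p ∣
nonempty⇒1≤∣p∣ (zero , here) = s≤s z≤n
nonempty⇒1≤∣p∣ {p = s ∷ p} (suc x , there x∈p) = ≤-trans (nonempty⇒1≤∣p∣ (x , x∈p)) (∣p∣≤∣x∷p∣ s p)

1≤m≤2⇒m≡1⊎m≡2 : ∀ {m} → 1 ≤ m → m ≤ 2 → m ≡ 1 ⊎ m ≡ 2
1≤m≤2⇒m≡1⊎m≡2 {1} _ _ = inj₁ refl
1≤m≤2⇒m≡1⊎m≡2 {2} _ _ = inj₂ refl
1≤m≤2⇒m≡1⊎m≡2 {suc (suc (suc _))} _ (s≤s (s≤s ()))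

a+b≤3⇒ : ∀ {a b} → 1 ≤ a → 1 ≤ b → a + b ≤ 3 → (a ≤ 1 × b ≤ 2) ⊎ (a ≤ 2 × b ≤ 1)
a+b≤3⇒ {1} _ _ (s≤s b≤2)       = inj₁ (≤-refl , b≤2)
a+b≤3⇒ {2} _ _ (s≤s (s≤s b≤1)) = inj₂ (≤-refl , b≤1)
a+b≤3⇒ {suc (suc (suc _))} _ 1≤b a+b≤3 = contradiction a+b≤3 (<⇒≱ (+-mono-≤ (s≤s (s≤s (s≤s z≤n))) 1≤b))

4≤a+b⇔ : ∀ {a b} → 1 ≤ a → 1 ≤ b → 4 ≤ a + b ⇔ (¬ ((a ≤ 1 × b ≤ 2) ⊎ (a ≤ 2 × b ≤ 1)))
4≤a+b⇔ 1≤a 1≤b = mk⇔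
  (λ 3<a+b → [ (λ (a≤1 , b≤2) → <⇒≱ 3<a+b (+-mono-≤ a≤1 b≤2))
             , (λ (a≤2 , b≤1) → <⇒≱ 3<a+b (+-mono-≤ a≤2 b≤1)) ])
  (λ ¬small → ≰⇒> (¬small ∘ a+b≤3⇒ 1≤a 1≤b))

foldr-⊓-lowerBound : ∀ m xs → All (foldr _⊓_ m xs ≤_) xs
foldr-⊓-lowerBound m xs = foldr-forcesᵇ ≤⊓⇒≤×≤ m xs ≤-refl
  where
  ≤⊓⇒≤×≤ : ∀ x y → foldr _⊓_ m xs ≤ x ⊓ y → foldr _⊓_ m xs ≤ x × foldr _⊓_ m xs ≤ y
  ≤⊓⇒≤×≤ x y le = ≤-trans le (m⊓n≤m x y) , ≤-trans le (m⊓n≤n x y)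

allSubsets-complete : ∀ k (p : Subset k) → p List.∈ allSubsets k
allSubsets-complete zero    []            = here refl
allSubsets-complete (suc k) (inside  ∷ p) = ∈-++⁺ˡ (∈-map⁺ (inside ∷_) (allSubsets-complete k p))
allSubsets-complete (suc k) (outside ∷ p) =
  ∈-++⁺ʳ (map (inside ∷_) (allSubsets k)) (∈-map⁺ (outside ∷_) (allSubsets-complete k p))

module _ (G : Graph) where

  γ≤∣D∣ : ∀ {D} → Dominating G D → γ G ≤ ∣ D ∣
  γ≤∣D∣ {D} dom = All.lookup (foldr-⊓-lowerBound (n G) _)
    (∈-map⁺ ∣_∣ (∈-filter⁺ (dominating? G) (allSubsets-complete (n G) D) dom))

  γ-attained : ∃[ D ] (Dominating G D × ∣ D ∣ ≡ γ G)
  γ-attained with foldr-selective ⊓-sel (n G) (map ∣_∣ (filter (dominating? G) (allSubsets (n G))))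
  ... | inj₁ γ≡n = ⊤ , (λ v → v , ∈⊤ , inj₁ refl) , trans (∣⊤∣≡n (n G)) (sym γ≡n)
  ... | inj₂ γ∈sizes =
    let D , D∈dominating , γ≡∣D∣ = ∈-map⁻ ∣_∣ γ∈sizes
    in D , proj₂ (∈-filter⁻ (dominating? G) {xs = allSubsets (n G)} D∈dominating) , sym γ≡∣D∣

  γ≤⇔ : γ G ≤ k ⇔ (∃[ D ] Dominating G D × ∣ D ∣ ≤ k)
  γ≤⇔ = mk⇔ (λ γ≤k → let D , dom , ∣D∣≡γ = γ-attained in D , dom , subst (_≤ _) (sym ∣D∣≡γ) γ≤k)
            (λ (D , dom , ∣D∣≤k) → ≤-trans (γ≤∣D∣ dom) ∣D∣≤k)

N[_] : (G : Graph) → Fin (n G) → Fin (n G) → Bool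
N[ G ] u v = does (inClosedNbhd? G u v)

HasUniversalVertex : Graph → Set
HasUniversalVertex G = ∃[ a ] AllTrue (N[ G ] a)

HasDominatingPair : Graph → Set
HasDominatingPair G = ∃₂ λ a b → Covers (N[ G ] a) (N[ G ] b)

HasSplittingPair : Graph → Set
HasSplittingPair G = ∃₂ λ a b → Complementary (N[ G ] a) (N[ G ] b)

module _ (G : Graph) where

  N[]≡true⇔ : ∀ {u v} → N[ G ] u v ≡ true ⇔ InClosedNbhd G u v
  N[]≡true⇔ {u} {v} = does≡true⇔ (inClosedNbhd? G u v)

  N[]-refl : ∀ u → N[ G ] u u ≡ true
  N[]-refl u = dec-true (inClosedNbhd? G u u) (inj₁ refl)

  private
    N[]-at-member : ∀ {a u v} → u ∈ ⁅ a ⁆ → InClosedNbhd G u v → N[ G ] a v ≡ true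
    N[]-at-member {a} {v = v} u∈⁅a⁆ u~v =
      from N[]≡true⇔ (subst (λ w → InClosedNbhd G w v) (x∈⁅y⁆⇒x≡y a u∈⁅a⁆) u~v)

  dominating-⁅⁆⇔ : ∀ {a} → Dominating G ⁅ a ⁆ ⇔ AllTrue (N[ G ] a)
  dominating-⁅⁆⇔ {a} = mk⇔ ⇒ ⇐
    where
    ⇒ : Dominating G ⁅ a ⁆ → AllTrue (N[ G ] a)
    ⇒ dom v = let u , u∈⁅a⁆ , u~v = dom v in N[]-at-member u∈⁅a⁆ u~v
    ⇐ : AllTrue (N[ G ] a) → Dominating G ⁅ a ⁆
    ⇐ all v = a , x∈⁅x⁆ a , to N[]≡true⇔ (all v)

  dominating-⁅⁆∪⁅⁆⇔ : ∀ {a b} → Dominating G (⁅ a ⁆ ∪ ⁅ b ⁆) ⇔ Covers (N[ G ] a) (N[ G ] b)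
  dominating-⁅⁆∪⁅⁆⇔ {a} {b} = mk⇔ ⇒ ⇐
    where
    ⇒ : Dominating G (⁅ a ⁆ ∪ ⁅ b ⁆) → Covers (N[ G ] a) (N[ G ] b)
    ⇒ dom v = let u , u∈D , u~v = dom v
              in Sum.map (λ u∈⁅a⁆ → N[]-at-member u∈⁅a⁆ u~v) (λ u∈⁅b⁆ → N[]-at-member u∈⁅b⁆ u~v)
                         (x∈p∪q⁻ ⁅ a ⁆ ⁅ b ⁆ u∈D)
    ⇐ : Covers (N[ G ] a) (N[ G ] b) → Dominating G (⁅ a ⁆ ∪ ⁅ b ⁆)
    ⇐ cov v = [ (λ a~v → a , x∈p∪q⁺ (inj₁ (x∈⁅x⁆ a)) , to N[]≡true⇔ a~v)
              , (λ b~v → b , x∈p∪q⁺ (inj₂ (x∈⁅x⁆ b)) , to N[]≡true⇔ b~v) ] (cov v)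

  module _ (v₀ : Fin (n G)) where

    1≤∣D∣ : ∀ {D} → Dominating G D → 1 ≤ ∣ D ∣
    1≤∣D∣ dom = let u , u∈D , _ = dom v₀ in nonempty⇒1≤∣p∣ (u , u∈D)

    1≤γ : 1 ≤ γ G
    1≤γ = let D , dom , ∣D∣≡γ = γ-attained G in subst (1 ≤_) ∣D∣≡γ (1≤∣D∣ dom)

    γ≤1⇔ : γ G ≤ 1 ⇔ HasUniversalVertex G
    γ≤1⇔ = mk⇔ ⇒ ⇐
      where
      ⇒ : γ G ≤ 1 → HasUniversalVertex G
      ⇒ γ≤1 = let D , dom , ∣D∣≤1 = to (γ≤⇔ G) γ≤1
                  x , D≡⁅x⁆ = ∣p∣≡1⇒p≡⁅x⁆ (≤-antisym ∣D∣≤1 (1≤∣D∣ dom))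
              in x , to dominating-⁅⁆⇔ (subst (Dominating G) D≡⁅x⁆ dom)
      ⇐ : HasUniversalVertex G → γ G ≤ 1
      ⇐ (x , all) = from (γ≤⇔ G) (⁅ x ⁆ , from dominating-⁅⁆⇔ all , ≤-reflexive (∣⁅x⁆∣≡1 x))

    γ≤2⇔ : γ G ≤ 2 ⇔ HasDominatingPair G
    γ≤2⇔ = mk⇔ ⇒ ⇐
      where
      single : ∀ {D} → Dominating G D → ∣ D ∣ ≡ 1 → HasDominatingPair G
      single dom ∣D∣≡1 = let x , D≡⁅x⁆ = ∣p∣≡1⇒p≡⁅x⁆ ∣D∣≡1
                         in x , x , inj₁ ∘ to dominating-⁅⁆⇔ (subst (Dominating G) D≡⁅x⁆ dom)
      pair : ∀ {D} → Dominating G D → ∣ D ∣ ≡ 2 → HasDominatingPair G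
      pair dom ∣D∣≡2 = let x , y , _ , D≡⁅x⁆∪⁅y⁆ = ∣p∣≡2⇒p≡⁅x⁆∪⁅y⁆ ∣D∣≡2
                       in x , y , to dominating-⁅⁆∪⁅⁆⇔ (subst (Dominating G) D≡⁅x⁆∪⁅y⁆ dom)
      ⇒ : γ G ≤ 2 → HasDominatingPair G
      ⇒ γ≤2 = let D , dom , ∣D∣≤2 = to (γ≤⇔ G) γ≤2
              in [ single dom , pair dom ] (1≤m≤2⇒m≡1⊎m≡2 (1≤∣D∣ dom) ∣D∣≤2)
      ⇐ : HasDominatingPair G → γ G ≤ 2
      ⇐ (x , y , cov) = from (γ≤⇔ G) (⁅ x ⁆ ∪ ⁅ y ⁆ , from dominating-⁅⁆∪⁅⁆⇔ cov , ∣⁅x⁆∪⁅y⁆∣≤2 x y)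

  complementary⇒≢ : ∀ {a b} → Complementary (N[ G ] a) (N[ G ] b) → a ≢ b
  complementary⇒≢ {a} comp refl = not-¬ refl (comp a)

  complementary⇔ : ∀ {a b} → Complementary (N[ G ] a) (N[ G ] b)
                             ⇔ (∀ v → ExactlyOne (InClosedNbhd G a v) (InClosedNbhd G b v))
  complementary⇔ {a} {b} = mk⇔ (λ comp v → to (exactlyOne⇔ v) (comp v)) (λ one v → from (exactlyOne⇔ v) (one v))
    where
    exactlyOne⇔ : ∀ v → N[ G ] b v ≡ not (N[ G ] a v) ⇔ ExactlyOne (InClosedNbhd G a v) (InClosedNbhd G b v)
    exactlyOne⇔ v = does≡not-does⇔ (inClosedNbhd? G a v) (inClosedNbhd? G b v)

  ecd-⁅⁆∪⁅⁆⇔ : ∀ {a b} → a ≢ b →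
               ECD G (⁅ a ⁆ ∪ ⁅ b ⁆) ⇔ (∀ v → ExactlyOne (InClosedNbhd G a v) (InClosedNbhd G b v))
  ecd-⁅⁆∪⁅⁆⇔ {a} {b} a≢b = mk⇔ ⇒ ⇐
    where
    a∈D : a ∈ ⁅ a ⁆ ∪ ⁅ b ⁆
    a∈D = x∈p∪q⁺ (inj₁ (x∈⁅x⁆ a))
    b∈D : b ∈ ⁅ a ⁆ ∪ ⁅ b ⁆
    b∈D = x∈p∪q⁺ (inj₂ (x∈⁅x⁆ b))

    ∈D⇒≡a⊎≡b : ∀ {u} → u ∈ ⁅ a ⁆ ∪ ⁅ b ⁆ → u ≡ a ⊎ u ≡ b
    ∈D⇒≡a⊎≡b u∈D = Sum.map (x∈⁅y⁆⇒x≡y a) (x∈⁅y⁆⇒x≡y b) (x∈p∪q⁻ ⁅ a ⁆ ⁅ b ⁆ u∈D)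

    ⇒ : ECD G (⁅ a ⁆ ∪ ⁅ b ⁆) → ∀ v → ExactlyOne (InClosedNbhd G a v) (InClosedNbhd G b v)
    ⇒ ecd v =
      let u , (u∈D , u~v) , unique = ecd v
      in Sum.map (λ u≡a → subst (λ w → InClosedNbhd G w v) u≡a u~v)
                 (λ u≡b → subst (λ w → InClosedNbhd G w v) u≡b u~v) (∈D⇒≡a⊎≡b u∈D)
       , λ (a~v , b~v) → a≢b (trans (unique a a∈D a~v) (sym (unique b b∈D b~v)))

    ⇐ : (∀ v → ExactlyOne (InClosedNbhd G a v) (InClosedNbhd G b v)) → ECD G (⁅ a ⁆ ∪ ⁅ b ⁆)
    ⇐ one v with one v
    ... | inj₁ a~v , ¬both = a , (a∈D , a~v) , λ w w∈D w~v →
            [ id , (λ { refl → contradiction (a~v , w~v) ¬both }) ] (∈D⇒≡a⊎≡b w∈D)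
    ... | inj₂ b~v , ¬both = b , (b∈D , b~v) , λ w w∈D w~v →
            [ (λ { refl → contradiction (w~v , b~v) ¬both }) , id ] (∈D⇒≡a⊎≡b w∈D)

  hasECDOfSize2⇔ : HasECDOfSize G 2 ⇔ HasSplittingPair G
  hasECDOfSize2⇔ = mk⇔ ⇒ ⇐
    where
    ⇒ : HasECDOfSize G 2 → HasSplittingPair G
    ⇒ (D , ecd , ∣D∣≡2) =
      let a , b , a≢b , D≡⁅a⁆∪⁅b⁆ = ∣p∣≡2⇒p≡⁅x⁆∪⁅y⁆ ∣D∣≡2
      in a , b , from complementary⇔ (to (ecd-⁅⁆∪⁅⁆⇔ a≢b) (subst (ECD G) D≡⁅a⁆∪⁅b⁆ ecd))
    ⇐ : HasSplittingPair G → HasECDOfSize G 2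
    ⇐ (a , b , comp) =
      let a≢b = complementary⇒≢ comp
      in ⁅ a ⁆ ∪ ⁅ b ⁆ , from (ecd-⁅⁆∪⁅⁆⇔ a≢b) (to complementary⇔ comp) , ∣⁅x⁆∪⁅y⁆∣≡2 a≢b

adj⇒≢ : ∀ G {u v} → Adj G u v → u ≢ v
adj⇒≢ G u~v refl = irrefl G u~v

HasAgreeingPairs : Graph → Graph → Set
HasAgreeingPairs G H = ∃₂ λ g₁ h₁ → ∃₂ λ g₂ h₂ → EitherAgrees (N[ G ] g₁) (N[ H ] h₁) (N[ G ] g₂) (N[ H ] h₂)

module _ (G H : Graph) where

  private
    π₁ : Fin (n G * n H) → Fin (n G)
    π₁ x = proj₁ (remQuot {n G} (n H) x)
    π₂ : Fin (n G * n H) → Fin (n H)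
    π₂ x = proj₂ (remQuot {n G} (n H) x)

    π-injective : ∀ {x y} → π₁ x ≡ π₁ y → π₂ x ≡ π₂ y → x ≡ y
    π-injective {x} {y} e₁ e₂ = begin
      x                      ≡⟨ combine-remQuot {n G} (n H) x ⟨
      combine (π₁ x) (π₂ x)  ≡⟨ cong₂ combine e₁ e₂ ⟩
      combine (π₁ y) (π₂ y)  ≡⟨ combine-remQuot {n G} (n H) y ⟩
      y                      ∎
      where open ≡-Reasoning

    Agree : Fin (n G) × Fin (n H) → Fin (n G) × Fin (n H) → Set
    Agree (g , h) (g′ , h′) = N[ G ] g g′ ≡ N[ H ] h h′

  ◇-closedNbhd⇔ : ∀ x y → InClosedNbhd (G ◇ H) x y
                          ⇔ BothOrNeither (InClosedNbhd G (π₁ x) (π₁ y)) (InClosedNbhd H (π₂ x) (π₂ y))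
  ◇-closedNbhd⇔ x y = mk⇔ ⇒ ⇐
    where
    ⇒ : InClosedNbhd (G ◇ H) x y → BothOrNeither (InClosedNbhd G (π₁ x) (π₁ y)) (InClosedNbhd H (π₂ x) (π₂ y))
    ⇒ (inj₁ x≡y)                                    = inj₁ (inj₁ (cong π₁ x≡y) , inj₁ (cong π₂ x≡y))
    ⇒ (inj₂ (_ , inj₁ (g≡g′ , h~h′)))               = inj₁ (inj₁ g≡g′ , inj₂ h~h′)
    ⇒ (inj₂ (_ , inj₂ (inj₁ (g~g′ , h≡h′))))        = inj₁ (inj₂ g~g′ , inj₁ h≡h′)
    ⇒ (inj₂ (_ , inj₂ (inj₂ (inj₁ (g~g′ , h~h′))))) = inj₁ (inj₂ g~g′ , inj₂ h~h′)
    ⇒ (inj₂ (_ , inj₂ (inj₂ (inj₂ (g≢g′ , h≢h′ , g≁g′ , h≁h′))))) = inj₂ ([ g≢g′ , g≁g′ ] , [ h≢h′ , h≁h′ ])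

    ⇐ : BothOrNeither (InClosedNbhd G (π₁ x) (π₁ y)) (InClosedNbhd H (π₂ x) (π₂ y)) → InClosedNbhd (G ◇ H) x y
    ⇐ (inj₁ (inj₁ g≡g′ , inj₁ h≡h′)) = inj₁ (π-injective g≡g′ h≡h′)
    ⇐ (inj₁ (inj₁ g≡g′ , inj₂ h~h′)) = inj₂ (adj⇒≢ H h~h′ ∘ cong π₂ , inj₁ (g≡g′ , h~h′))
    ⇐ (inj₁ (inj₂ g~g′ , inj₁ h≡h′)) = inj₂ (adj⇒≢ G g~g′ ∘ cong π₁ , inj₂ (inj₁ (g~g′ , h≡h′)))
    ⇐ (inj₁ (inj₂ g~g′ , inj₂ h~h′)) = inj₂ (adj⇒≢ G g~g′ ∘ cong π₁ , inj₂ (inj₂ (inj₁ (g~g′ , h~h′))))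
    ⇐ (inj₂ (g≁g′ , h≁h′)) =
      inj₂ (g≁g′ ∘ inj₁ ∘ cong π₁ , inj₂ (inj₂ (inj₂ (g≁g′ ∘ inj₁ , h≁h′ ∘ inj₁ , g≁g′ ∘ inj₂ , h≁h′ ∘ inj₂))))

  ◇-N[]≡true⇔ : ∀ x y → N[ G ◇ H ] x y ≡ true ⇔ Agree (remQuot (n H) x) (remQuot (n H) y)
  ◇-N[]≡true⇔ x y = ⇔-trans (N[]≡true⇔ (G ◇ H)) (⇔-trans (◇-closedNbhd⇔ x y)
    (⇔-sym (does≡does⇔ (inClosedNbhd? G (π₁ x) (π₁ y)) (inClosedNbhd? H (π₂ x) (π₂ y)))))

  ◇-hasDominatingPair⇔hasAgreeingPairs : HasDominatingPair (G ◇ H) ⇔ HasAgreeingPairs G H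
  ◇-hasDominatingPair⇔hasAgreeingPairs = mk⇔ ⇒ ⇐
    where
    agree-with : ∀ x g h → N[ G ◇ H ] x (combine g h) ≡ true → Agree (remQuot (n H) x) (g , h)
    agree-with x g h = subst (Agree (remQuot (n H) x)) (remQuot-combine g h) ∘ to (◇-N[]≡true⇔ x (combine g h))

    dominates : ∀ g h z → Agree (g , h) (remQuot (n H) z) → N[ G ◇ H ] (combine g h) z ≡ true
    dominates g h z =
      from (◇-N[]≡true⇔ (combine g h) z) ∘ subst (λ s → Agree s (remQuot (n H) z)) (sym (remQuot-combine g h))

    ⇒ : HasDominatingPair (G ◇ H) → HasAgreeingPairs G H
    ⇒ (x , y , cov) =
      π₁ x , π₂ x , π₁ y , π₂ y , λ g h → Sum.map (agree-with x g h) (agree-with y g h) (cov (combine g h))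

    ⇐ : HasAgreeingPairs G H → HasDominatingPair (G ◇ H)
    ⇐ (g₁ , h₁ , g₂ , h₂ , agree) =
      combine g₁ h₁ , combine g₂ h₂ , λ z → Sum.map (dominates g₁ h₁ z) (dominates g₂ h₂ z) (agree (π₁ z) (π₂ z))

  hasAgreeingPairs⇒ : HasAgreeingPairs G H →
    ((HasUniversalVertex G × HasDominatingPair H) ⊎ (HasDominatingPair G × HasUniversalVertex H))
    ⊎ HasSplittingPair G ⊎ HasSplittingPair H
  hasAgreeingPairs⇒ (g₁ , h₁ , g₂ , h₂ , agree) with eitherAgrees-cases agree (N[]-refl G g₂) (N[]-refl H h₁)
  ... | inj₁ (inj₁ (allG , covH)) = inj₁ (inj₁ ((g₁ , allG) , (h₁ , h₂ , covH)))
  ... | inj₁ (inj₂ (covG , allH)) = inj₁ (inj₂ ((g₁ , g₂ , covG) , (h₂ , allH)))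
  ... | inj₂ (inj₁ compG)         = inj₂ (inj₁ (g₁ , g₂ , compG))
  ... | inj₂ (inj₂ compH)         = inj₂ (inj₂ (h₁ , h₂ , compH))

  ⇒hasAgreeingPairs : Fin (n G) → Fin (n H) →
    ((HasUniversalVertex G × HasDominatingPair H) ⊎ (HasDominatingPair G × HasUniversalVertex H))
    ⊎ HasSplittingPair G ⊎ HasSplittingPair H → HasAgreeingPairs G H
  ⇒hasAgreeingPairs _ _ (inj₁ (inj₁ ((a , allG) , (b₁ , b₂ , covH)))) =
    a , b₁ , a , b₂ , λ g h → Sum.map (trans (allG g) ∘ sym) (trans (allG g) ∘ sym) (covH h)
  ⇒hasAgreeingPairs _ _ (inj₁ (inj₂ ((a₁ , a₂ , covG) , (b , allH)))) =
    a₁ , b , a₂ , b , λ g h → Sum.map (λ t → trans t (sym (allH h))) (λ t → trans t (sym (allH h))) (covG g)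
  ⇒hasAgreeingPairs _ h₀ (inj₂ (inj₁ (a , b , compG))) =
    a , h₀ , b , h₀ , λ g h → Sum.map sym (λ e → trans (compG g) (sym e)) (≡⊎≡not (N[ H ] h₀ h) (N[ G ] a g))
  ⇒hasAgreeingPairs g₀ _ (inj₂ (inj₂ (a , b , compH))) =
    g₀ , a , g₀ , b , λ g h → Sum.map₂ (λ e → trans e (sym (compH h))) (≡⊎≡not (N[ G ] g₀ g) (N[ H ] a h))

  γ[G◇H]≤2⇔ : Fin (n G) → Fin (n H) →
    γ (G ◇ H) ≤ 2 ⇔ (((γ G ≤ 1 × γ H ≤ 2) ⊎ (γ G ≤ 2 × γ H ≤ 1)) ⊎ HasECDOfSize G 2 ⊎ HasECDOfSize H 2)
  γ[G◇H]≤2⇔ g₀ h₀ = begin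
    (γ (G ◇ H) ≤ 2)             ≈⟨ γ≤2⇔ (G ◇ H) (combine g₀ h₀) ⟩
    HasDominatingPair (G ◇ H)   ≈⟨ ◇-hasDominatingPair⇔hasAgreeingPairs ⟩
    HasAgreeingPairs G H        ≈⟨ mk⇔ hasAgreeingPairs⇒ (⇒hasAgreeingPairs g₀ h₀) ⟩
    (((HasUniversalVertex G × HasDominatingPair H) ⊎ (HasDominatingPair G × HasUniversalVertex H))
     ⊎ HasSplittingPair G ⊎ HasSplittingPair H)
      ≈⟨ ((γ≤1⇔ G g₀ ×-⇔ γ≤2⇔ H h₀) ⊎-⇔ (γ≤2⇔ G g₀ ×-⇔ γ≤1⇔ H h₀)) ⊎-⇔ hasECDOfSize2⇔ G ⊎-⇔ hasECDOfSize2⇔ H ⟨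
    (((γ G ≤ 1 × γ H ≤ 2) ⊎ (γ G ≤ 2 × γ H ≤ 1)) ⊎ HasECDOfSize G 2 ⊎ HasECDOfSize H 2)  ∎
    where open SetoidReasoning (⇔-setoid 0ℓ)

corollary24 : (G H : Graph) → 1 ≤ n G → 1 ≤ n H →
    (3 ≤ γ (G ◇ H)) ⇔ ((4 ≤ γ G + γ H) × ¬ HasECDOfSize G 2 × ¬ HasECDOfSize H 2)
corollary24 G H 1≤nG 1≤nH = begin
  (3 ≤ γ (G ◇ H))                                                ≈⟨ mk⇔ <⇒≱ ≰⇒> ⟩
  (¬ γ (G ◇ H) ≤ 2)                                              ≈⟨ ¬-cong-⇔ (γ[G◇H]≤2⇔ G H g₀ h₀) ⟩
  (¬ (((γ G ≤ 1 × γ H ≤ 2) ⊎ (γ G ≤ 2 × γ H ≤ 1)) ⊎ HasECDOfSize G 2 ⊎ HasECDOfSize H 2))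
                                                                 ≈⟨ ⇔-trans ¬-⊎⇔ (⇔-refl ×-⇔ ¬-⊎⇔) ⟩
  (¬ ((γ G ≤ 1 × γ H ≤ 2) ⊎ (γ G ≤ 2 × γ H ≤ 1)) × ¬ HasECDOfSize G 2 × ¬ HasECDOfSize H 2)
                                                                 ≈⟨ 4≤a+b⇔ (1≤γ G g₀) (1≤γ H h₀) ×-⇔ ⇔-refl ⟨
  ((4 ≤ γ G + γ H) × ¬ HasECDOfSize G 2 × ¬ HasECDOfSize H 2)    ∎
  where
  open SetoidReasoning (⇔-setoid 0ℓ)
  g₀ : Fin (n G)
  g₀ = fromℕ< 1≤nG
  h₀ : Fin (n H)
  h₀ = fromℕ< 1≤nH
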